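{- Let $n\ge 3$ and let $g$ and $h$ be distinct transpositions of $\mathrm{S}_n$. Then the only $4$-cycles in $CT_n$ passing through the $2$-path $(g,\mathrm{id},h)$ are $(\mathrm{id},g,hg,h,\mathrm{id})$ and $(\mathrm{id},g,gh,h,\mathrm{id})$. In particular, if $gh=hg$, then these two $4$-cycles are identical and it is the only $4$-cycle in $CT_n$ passing through $(g,\mathrm{id},h)$.
   Context: $\mathrm{S}_n$ is the symmetric group on $\{1,\dots,n\}$ with identity $\mathrm{id}$. $CT_n$ is the Cayley graph on $\mathrm{S}_n$ with vertex set $\mathrm{S}_n$, where $x,y$ are adjacent iff $y=ux$ for some transposition $u$ of $\mathrm{S}_n$. -}

module Defs where

open import Data.Nat using (ℕ)
open import Data.Fin using (Fin)
open import Data.Product using (Σ; ∃; _×_; _,_)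
open import Relation.Nullary using (¬_)
open import Relation.Binary.PropositionalEquality using (_≢_)
open import Data.Fin.Permutation
  using (Permutation′; _≈_; _∘ₚ_; id; transpose)

-- The symmetric group S_n, elements as permutations of Fin n;
-- group equality is the library's pointwise equality _≈_.
S : ℕ → Set
S n = Permutation′ n

-- Group product, written as in the paper: (x · y)(k) = x (y k),
-- i.e. apply y first, then x.  (Library _∘ₚ_ is diagrammatic.)
_·_ : ∀ {n} → S n → S n → S n
x · y = y ∘ₚ x

IsTransposition : ∀ {n} → S n → Set
IsTransposition {n} u = Σ (Fin n) λ i → Σ (Fin n) λ j → i ≢ j × u ≈ transpose i j

Adj : ∀ {n} → S n → S n → Set
Adj {n} x y = Σ (S n) λ u → IsTransposition u × y ≈ (u · x)

Is4Cycle : ∀ {n} → S n → S n → S n → S n → Set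
Is4Cycle v₀ v₁ v₂ v₃ =
  (Adj v₀ v₁ × Adj v₁ v₂ × Adj v₂ v₃ × Adj v₃ v₀) ×
  (¬ v₀ ≈ v₁ × ¬ v₀ ≈ v₂ × ¬ v₀ ≈ v₃ × ¬ v₁ ≈ v₂ × ¬ v₁ ≈ v₃ × ¬ v₂ ≈ v₃)

-- A common neighbour x ≠ id of g and h in CT_n is x = u g = v h with u, v transpositions.
-- Such an x moves every point of the supports of g and h (if g = (a b) and x a = a, then
-- u b = a, so u = g and x = id), and fixes every point outside both (a point c moved
-- there would give u = (c, x c) = v, hence g = h).  Pick c in the support of h = (c d)
-- fixed by g, so u moves c to s = x c and u = (c s).  If s = d then u = h and x = h g;
-- otherwise these constraints force g = (d s), so u = (g c, g d) = g h g⁻¹ and x = g h.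
module Submission where

open import Defs
open import Data.Nat using (ℕ; _≥_)
open import Data.Fin using (Fin)
open import Data.Fin.Properties using (_≟_)
open import Data.Fin.Permutation using (_≈_; id; _⟨$⟩ʳ_; _⟨$⟩ˡ_; inverseˡ; inverseʳ; transpose)
import Data.Fin.Permutation.Components as PC
open import Data.Product using (_×_; _,_)
open import Data.Sum using (_⊎_; inj₁; inj₂; [_,_]′)
open import Data.Empty using (⊥-elim)
open import Function using (_∘_)
open import Relation.Nullary using (¬_; Dec; yes; no)
open import Relation.Nullary.Decidable using (dec-true; dec-false)
open import Relation.Binary.PropositionalEquality
  using (_≡_; _≢_; refl; sym; trans; cong; subst; subst₂; ≢-sym; module ≡-Reasoning)

private
  variable
    n : ℕ
    g h t u v₀ v₁ v₂ v₃ : S n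
    a b c d p q : Fin n

⟦_⟧ : S n → Fin n → Fin n
⟦ π ⟧ = π ⟨$⟩ʳ_

⟦⟧-injective : (π : S n) → ⟦ π ⟧ a ≡ ⟦ π ⟧ b → a ≡ b
⟦⟧-injective {a = a} {b} π e = trans (sym (inverseˡ π)) (trans (cong (π ⟨$⟩ˡ_) e) (inverseˡ π))

transpose-matchˡ : (a b : Fin n) → PC.transpose a b a ≡ b
transpose-matchˡ a b rewrite dec-true (a ≟ a) refl = refl

transpose-matchʳ : (a b : Fin n) → PC.transpose a b b ≡ a
transpose-matchʳ a b with b ≟ a
... | yes b≡a = b≡a
... | no _ rewrite dec-true (b ≟ b) refl = refl

transpose-other : c ≢ a → c ≢ b → PC.transpose a b c ≡ c
transpose-other {c = c} {a} {b} c≢a c≢b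
  rewrite dec-false (c ≟ a) c≢a | dec-false (c ≟ b) c≢b = refl

record IsTranspositionOf (t : S n) (a b : Fin n) : Set where
  constructor swaps
  field
    a≢b : a ≢ b
    t≈transpose : t ≈ transpose a b

  maps-a : ⟦ t ⟧ a ≡ b
  maps-a = trans (t≈transpose a) (transpose-matchˡ a b)

  maps-b : ⟦ t ⟧ b ≡ a
  maps-b = trans (t≈transpose b) (transpose-matchʳ a b)

  fixes-others : c ≢ a → c ≢ b → ⟦ t ⟧ c ≡ c
  fixes-others c≢a c≢b = trans (t≈transpose _) (transpose-other c≢a c≢b)

  moved⇒endpoint : ⟦ t ⟧ c ≢ c → c ≡ a ⊎ c ≡ b
  moved⇒endpoint {c} tc≢c with c ≟ a | c ≟ b
  ... | yes c≡a | _       = inj₁ c≡a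
  ... | no _    | yes c≡b = inj₂ c≡b
  ... | no c≢a  | no c≢b  = ⊥-elim (tc≢c (fixes-others c≢a c≢b))

  involutive : ∀ c → ⟦ t ⟧ (⟦ t ⟧ c) ≡ c
  involutive c with c ≟ a | c ≟ b
  ... | yes refl | _        = trans (cong ⟦ t ⟧ maps-a) maps-b
  ... | no _     | yes refl = trans (cong ⟦ t ⟧ maps-b) maps-a
  ... | no c≢a   | no c≢b   = trans (cong ⟦ t ⟧ (fixes-others c≢a c≢b)) (fixes-others c≢a c≢b)

isTranspositionOf : a ≢ b → ⟦ t ⟧ a ≡ b → ⟦ t ⟧ b ≡ a →
                    (∀ {c} → c ≢ a → c ≢ b → ⟦ t ⟧ c ≡ c) → IsTranspositionOf t a b
isTranspositionOf {a = a} {b} {t} a≢b ta tb others = swaps a≢b agree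
  where
  agree : ∀ c → ⟦ t ⟧ c ≡ PC.transpose a b c
  agree c = by-cases c (c ≟ a) (c ≟ b)
    where
    by-cases : ∀ c → Dec (c ≡ a) → Dec (c ≡ b) → ⟦ t ⟧ c ≡ PC.transpose a b c
    by-cases _ (yes refl) _          = trans ta (sym (transpose-matchˡ a b))
    by-cases _ (no _)     (yes refl) = trans tb (sym (transpose-matchʳ a b))
    by-cases _ (no c≢a)   (no c≢b)   = trans (others c≢a c≢b) (sym (transpose-other c≢a c≢b))

swap : IsTranspositionOf t a b → IsTranspositionOf t b a
swap τ = isTranspositionOf (≢-sym a≢b) maps-b maps-a (λ c≢b c≢a → fixes-others c≢a c≢b)
  where open IsTranspositionOf τ

moved⇒IsTranspositionOf : IsTranspositionOf t a b → ⟦ t ⟧ p ≡ q → p ≢ q → IsTranspositionOf t p q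
moved⇒IsTranspositionOf {t = t} {a} {b} τ tp≡q p≢q
  with IsTranspositionOf.moved⇒endpoint τ (λ tp≡p → p≢q (trans (sym tp≡p) tp≡q))
... | inj₁ refl = subst (IsTranspositionOf t a) (trans (sym (IsTranspositionOf.maps-a τ)) tp≡q) τ
... | inj₂ refl = subst (IsTranspositionOf t b) (trans (sym (IsTranspositionOf.maps-b τ)) tp≡q) (swap τ)

same-points⇒≈ : IsTranspositionOf t a b → IsTranspositionOf u a b → t ≈ u
same-points⇒≈ τ υ c = trans (t≈transpose τ c) (sym (t≈transpose υ c))
  where open IsTranspositionOf using (t≈transpose)

toIsTransposition : IsTranspositionOf t a b → IsTransposition t
toIsTransposition (swaps a≢b t≈) = _ , _ , a≢b , t≈

agree-on-moved⇒≈ : IsTranspositionOf t a b → IsTranspositionOf u c d →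
                   ⟦ t ⟧ p ≡ ⟦ u ⟧ p → ⟦ t ⟧ p ≢ p → t ≈ u
agree-on-moved⇒≈ τ υ tp≡up tp≢p =
  same-points⇒≈ (moved⇒IsTranspositionOf τ refl (≢-sym tp≢p))
                (moved⇒IsTranspositionOf υ (sym tp≡up) (≢-sym tp≢p))

moving-two⇒swaps : IsTranspositionOf t a b → ⟦ t ⟧ p ≢ p → ⟦ t ⟧ q ≢ q → p ≢ q → ⟦ t ⟧ p ≡ q
moving-two⇒swaps τ tp≢p tq≢q p≢q =
  [ (λ q≡p → ⊥-elim (p≢q (sym q≡p))) , sym ]′
  (IsTranspositionOf.moved⇒endpoint (moved⇒IsTranspositionOf τ refl (≢-sym tp≢p)) tq≢q)

conjugate : (π : S n) → IsTranspositionOf t a b → IsTranspositionOf u (⟦ π ⟧ a) (⟦ π ⟧ b) →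
            ∀ c → ⟦ u ⟧ (⟦ π ⟧ c) ≡ ⟦ π ⟧ (⟦ t ⟧ c)
conjugate {t = t} {a} {b} {u} π τ υ c = by-cases c (c ≟ a) (c ≟ b)
  where
  module T = IsTranspositionOf τ
  module U = IsTranspositionOf υ
  by-cases : ∀ c → Dec (c ≡ a) → Dec (c ≡ b) → ⟦ u ⟧ (⟦ π ⟧ c) ≡ ⟦ π ⟧ (⟦ t ⟧ c)
  by-cases _ (yes refl) _          = trans U.maps-a (cong ⟦ π ⟧ (sym T.maps-a))
  by-cases _ (no _)     (yes refl) = trans U.maps-b (cong ⟦ π ⟧ (sym T.maps-b))
  by-cases _ (no c≢a)   (no c≢b)   =
    trans (U.fixes-others (c≢a ∘ ⟦⟧-injective π) (c≢b ∘ ⟦⟧-injective π))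
          (cong ⟦ π ⟧ (sym (T.fixes-others c≢a c≢b)))

≈·-flip : (x y : S n) → IsTranspositionOf u a b → y ≈ u · x → x ≈ u · y
≈·-flip {u = u} x y υ y≈ux c =
  trans (sym (IsTranspositionOf.involutive υ (⟦ x ⟧ c))) (cong ⟦ u ⟧ (sym (y≈ux c)))

Adj-sym : (x y : S n) → Adj x y → Adj y x
Adj-sym x y (u , u-tr@(_ , _ , a≢b , u≈) , y≈ux) =
  u , u-tr , ≈·-flip x y (swaps {t = u} a≢b u≈) y≈ux

Adj-·ˡ : (x : S n) → IsTranspositionOf t a b → Adj x (t · x)
Adj-·ˡ {t = t} x τ = t , toIsTransposition τ , λ _ → refl

Adj-·ʳ : (x : S n) → IsTranspositionOf t a b → Adj x (x · t)
Adj-·ʳ {a = a} {b} x τ =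
  transpose (⟦ x ⟧ a) (⟦ x ⟧ b) , toIsTransposition x-conj , λ c → sym (conjugate x τ x-conj c)
  where
  x-conj : IsTranspositionOf (transpose (⟦ x ⟧ a) (⟦ x ⟧ b)) (⟦ x ⟧ a) (⟦ x ⟧ b)
  x-conj = swaps (IsTranspositionOf.a≢b τ ∘ ⟦⟧-injective x) (λ _ → refl)

id≉transposition : IsTranspositionOf t a b → ¬ id ≈ t
id≉transposition τ id≈t = a≢b (trans (id≈t _) maps-a)
  where open IsTranspositionOf τ

id≈t·u⇒u≈t : (u : S n) → IsTranspositionOf t a b → id ≈ t · u → u ≈ t
id≈t·u⇒u≈t {t = t} _ τ id≈tu c = sym (trans (cong ⟦ t ⟧ (id≈tu c)) (involutive _))
  where open IsTranspositionOf τ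

x≉t·x : (x : S n) → IsTranspositionOf t a b → ¬ x ≈ t · x
x≉t·x {t = t} x τ x≈tx =
  a≢b (trans (sym (inverseʳ x)) (trans (x≈tx _) (trans (cong ⟦ t ⟧ (inverseʳ x)) maps-a)))
  where open IsTranspositionOf τ

x·t≉x : (x : S n) → IsTranspositionOf t a b → ¬ x · t ≈ x
x·t≉x x τ xt≈x = a≢b (sym (trans (sym maps-a) (⟦⟧-injective x (xt≈x _))))
  where open IsTranspositionOf τ

Is4Cycle-reverse : Is4Cycle v₀ v₁ v₂ v₃ → Is4Cycle v₀ v₃ v₂ v₁
Is4Cycle-reverse {v₀ = v₀} {v₁} {v₂} {v₃}
  ((e₀₁ , e₁₂ , e₂₃ , e₃₀) , (n₀₁ , n₀₂ , n₀₃ , n₁₂ , n₁₃ , n₂₃)) =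
  (Adj-sym v₃ v₀ e₃₀ , Adj-sym v₂ v₃ e₂₃ , Adj-sym v₁ v₂ e₁₂ , Adj-sym v₀ v₁ e₀₁) ,
  (n₀₃ , n₀₂ , n₀₁ , (λ e → n₂₃ (sym ∘ e)) , (λ e → n₁₃ (sym ∘ e)) , (λ e → n₁₂ (sym ∘ e)))

h·g-cycle : IsTranspositionOf g a b → IsTranspositionOf h c d → ¬ g ≈ h → Is4Cycle id g (h · g) h
h·g-cycle {g = g} {h = h} γ η g≉h =
  (Adj-·ˡ id γ , Adj-·ˡ g η , Adj-sym h (h · g) (Adj-·ʳ h γ) , Adj-sym id h (Adj-·ˡ id η)) ,
  (id≉transposition γ , g≉h ∘ id≈t·u⇒u≈t g η , id≉transposition η , x≉t·x g η , g≉h , x·t≉x h γ)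

moves-support : (x : S n) → IsTranspositionOf g a b → Adj g x → ¬ id ≈ x → ⟦ x ⟧ a ≢ a
moves-support {g = g} {a} {b} x γ (u , (_ , _ , c≢d , u≈) , x≈ug) x≉id xa≡a =
  x≉id λ c → sym (trans (x≈ug c) (trans (u≈g (⟦ g ⟧ c)) (involutive c)))
  where
  open IsTranspositionOf γ
  ub≡a : ⟦ u ⟧ b ≡ a
  ub≡a = trans (cong ⟦ u ⟧ (sym maps-a)) (trans (sym (x≈ug a)) xa≡a)
  u≈g : u ≈ g
  u≈g = agree-on-moved⇒≈ (swaps {t = u} c≢d u≈) γ (trans ub≡a (sym maps-b))
                         (λ ub≡b → a≢b (trans (sym ub≡a) ub≡b))

fixed-outside-supports : (x : S n) → ¬ g ≈ h → Adj g x → Adj h x →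
                         ⟦ g ⟧ c ≡ c → ⟦ h ⟧ c ≡ c → ⟦ x ⟧ c ≡ c
fixed-outside-supports {g = g} {h} {c} x g≉h
  (u , (_ , _ , a≢b , u≈) , x≈ug) (v , (_ , _ , p≢q , v≈) , x≈vh) gc≡c hc≡c
  with ⟦ x ⟧ c ≟ c
... | yes xc≡c = xc≡c
... | no xc≢c  = ⊥-elim (g≉h g≈h)
  where
  υ = swaps {t = u} a≢b u≈
  ν = swaps {t = v} p≢q v≈
  uc≡xc : ⟦ u ⟧ c ≡ ⟦ x ⟧ c
  uc≡xc = trans (cong ⟦ u ⟧ (sym gc≡c)) (sym (x≈ug c))
  vc≡xc : ⟦ v ⟧ c ≡ ⟦ x ⟧ c
  vc≡xc = trans (cong ⟦ v ⟧ (sym hc≡c)) (sym (x≈vh c))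
  u≈v : u ≈ v
  u≈v = agree-on-moved⇒≈ υ ν (trans uc≡xc (sym vc≡xc)) (λ uc≡c → xc≢c (trans (sym uc≡xc) uc≡c))
  open ≡-Reasoning
  g≈h : g ≈ h
  g≈h k = begin
    ⟦ g ⟧ k               ≡⟨ ≈·-flip g x υ x≈ug k ⟩
    ⟦ u ⟧ (⟦ x ⟧ k)       ≡⟨ u≈v (⟦ x ⟧ k) ⟩
    ⟦ v ⟧ (⟦ x ⟧ k)       ≡⟨ sym (≈·-flip h x ν x≈vh k) ⟩
    ⟦ h ⟧ k               ∎

fixes-endpoint : IsTranspositionOf g a b → IsTranspositionOf h c d → ¬ g ≈ h →
                 ⟦ g ⟧ c ≡ c ⊎ ⟦ g ⟧ d ≡ d
fixes-endpoint {g = g} {h = h} {c = c} {d} γ η g≉h with ⟦ g ⟧ c ≟ c | ⟦ g ⟧ d ≟ d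
... | yes gc≡c | _        = inj₁ gc≡c
... | no _     | yes gd≡d = inj₂ gd≡d
... | no gc≢c  | no gd≢d  = ⊥-elim (g≉h (agree-on-moved⇒≈ γ η gc≡hc gc≢c))
  where
  gc≡hc : ⟦ g ⟧ c ≡ ⟦ h ⟧ c
  gc≡hc = trans (moving-two⇒swaps γ gc≢c gd≢d (IsTranspositionOf.a≢b η))
                (sym (IsTranspositionOf.maps-a η))

module CommonNeighbour
  {g h u x : S n} {a b c d p q : Fin n}
  (γ : IsTranspositionOf g a b) (η : IsTranspositionOf h c d) (g≉h : ¬ g ≈ h)
  (υ : IsTranspositionOf u p q) (x≈ug : x ≈ u · g) (hx : Adj h x) (x≉id : ¬ id ≈ x)
  (gc≡c : ⟦ g ⟧ c ≡ c)
  where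

  private
    open IsTranspositionOf

    xc≢c : ⟦ x ⟧ c ≢ c
    xc≢c = moves-support x η hx x≉id

    υᶜ : IsTranspositionOf u c (⟦ x ⟧ c)
    υᶜ = moved⇒IsTranspositionOf υ (trans (cong ⟦ u ⟧ (sym gc≡c)) (sym (x≈ug c))) (≢-sym xc≢c)

    x≈h·g : ⟦ x ⟧ c ≡ d → x ≈ h · g
    x≈h·g xc≡d k =
      trans (x≈ug k) (same-points⇒≈ (subst (IsTranspositionOf u c) xc≡d υᶜ) η (⟦ g ⟧ k))

    module _ (xc≢d : ⟦ x ⟧ c ≢ d) where

      gs≢s : ⟦ g ⟧ (⟦ x ⟧ c) ≢ ⟦ x ⟧ c
      gs≢s gs≡s = xc≢c (trans (sym xs≡s) xs≡c)
        where
        xs≡c : ⟦ x ⟧ (⟦ x ⟧ c) ≡ c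
        xs≡c = trans (x≈ug _) (trans (cong ⟦ u ⟧ gs≡s) (maps-b υᶜ))
        xs≡s : ⟦ x ⟧ (⟦ x ⟧ c) ≡ ⟦ x ⟧ c
        xs≡s = fixed-outside-supports {g = g} {h} x g≉h (u , toIsTransposition υ , x≈ug) hx gs≡s
                                      (fixes-others η xc≢c xc≢d)

      gd≢d : ⟦ g ⟧ d ≢ d
      gd≢d gd≡d = [ a≢b η ∘ sym , xc≢d ∘ sym ]′ (moved⇒endpoint υᶜ ud≢d)
        where
        ud≢d : ⟦ u ⟧ d ≢ d
        ud≢d ud≡d =
          moves-support x (swap η) hx x≉id (trans (x≈ug d) (trans (cong ⟦ u ⟧ gd≡d) ud≡d))

      x≈g·h : x ≈ g · h
      x≈g·h k = trans (x≈ug k) (conjugate g η υᵍ k)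
        where
        gd≡s : ⟦ g ⟧ d ≡ ⟦ x ⟧ c
        gd≡s = moving-two⇒swaps γ gd≢d gs≢s (≢-sym xc≢d)
        υᵍ : IsTranspositionOf u (⟦ g ⟧ c) (⟦ g ⟧ d)
        υᵍ = subst₂ (IsTranspositionOf u) (sym gc≡c) (sym gd≡s) υᶜ

  h·g⊎g·h : x ≈ h · g ⊎ x ≈ g · h
  h·g⊎g·h with ⟦ x ⟧ c ≟ d
  ... | yes xc≡d = inj₁ (x≈h·g xc≡d)
  ... | no xc≢d  = inj₂ (x≈g·h xc≢d)

common-neighbour : (x : S n) → IsTranspositionOf g a b → IsTranspositionOf h c d → ¬ g ≈ h →
                   Adj g x → Adj h x → ¬ id ≈ x → x ≈ h · g ⊎ x ≈ g · h
common-neighbour x γ η g≉h (u , (_ , _ , p≢q , u≈) , x≈ug) hx x≉id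
  with fixes-endpoint γ η g≉h
... | inj₁ gc≡c = CommonNeighbour.h·g⊎g·h {x = x} γ η g≉h υ x≈ug hx x≉id gc≡c
  where υ = swaps {t = u} p≢q u≈
... | inj₂ gd≡d = CommonNeighbour.h·g⊎g·h {x = x} γ (swap η) g≉h υ x≈ug hx x≉id gd≡d
  where υ = swaps {t = u} p≢q u≈

lemma2p2 : (n : ℕ) → n ≥ 3 → (g h : S n) → IsTransposition g → IsTransposition h → ¬ g ≈ h →
    (Is4Cycle id g (h · g) h × Is4Cycle id g (g · h) h ×
      ((x : S n) → Is4Cycle id g x h → x ≈ (h · g) ⊎ x ≈ (g · h))) ×
    ((g · h) ≈ (h · g) → (x : S n) → Is4Cycle id g x h → x ≈ (g · h))
lemma2p2 n _ g h (_ , _ , a≢b , g≈) (_ , _ , c≢d , h≈) g≉h =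
  (h·g-cycle γ η g≉h , g·h-cycle , neighbours) , commuting
  where
  γ = swaps {t = g} a≢b g≈
  η = swaps {t = h} c≢d h≈

  g·h-cycle : Is4Cycle id g (g · h) h
  g·h-cycle = Is4Cycle-reverse {v₀ = id} {h} {g · h} {g} (h·g-cycle η γ (λ h≈g → g≉h (sym ∘ h≈g)))

  neighbours : (x : S n) → Is4Cycle id g x h → x ≈ (h · g) ⊎ x ≈ (g · h)
  neighbours x ((_ , gx , xh , _) , (_ , x≉id , _)) =
    common-neighbour x γ η g≉h gx (Adj-sym x h xh) x≉id

  commuting : (g · h) ≈ (h · g) → (x : S n) → Is4Cycle id g x h → x ≈ (g · h)
  commuting gh≈hg x cycle with neighbours x cycle
  ... | inj₁ x≈hg = λ k → trans (x≈hg k) (sym (gh≈hg k))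
  ... | inj₂ x≈gh = x≈gh
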